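{- Let $G$ be any group. Then $R_G(G)$, the radius of $G$ in $G$, equals the rank of $G$ (the minimal cardinality of a generating set of $G$, taken to be $\infty$ if $G$ is not finitely generated).
   Context: For a group $G$ and a subgroup $H$, let $\chi_H\colon G\to\{0,1\}$ be the characteristic function of $H$, and let $A_G$ be the set of characteristic functions of all subgroups of $G$, partially ordered by equality. For $S\subseteq G$, $\chi_H$ is Occam on $S$ if $\chi_H$ is the only element of $A_G$ agreeing with $\chi_H$ on $S$. The radius $R_G(H)$ is $\min\{|S| : S\subseteq G,\ \chi_H \text{ is Occam on } S\}$ if this is finite, and $\infty$ otherwise. -}

module Defs where

open import Level using (Level; _⊔_; suc)
open import Algebra.Bundles using (Group)
open import Data.List using (List; length)
open import Data.Nat using (ℕ; _≤_)
open import Data.Product using (Σ; _×_; ∃; _,_)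
open import Data.Unit.Polymorphic using (⊤)
open import Function.Bundles using (_⇔_)
import Data.List.Membership.Setoid as Mem
import Data.List.Relation.Unary.Unique.Setoid as Uniq

module _ {c ℓ : Level} (G : Group c ℓ) where
  open Group G

  record Subgroup (p : Level) : Set (c ⊔ ℓ ⊔ suc p) where
    field
      mem   : Carrier → Set p
      resp  : ∀ {x y} → x ≈ y → mem x → mem y
      ε-mem : mem ε
      ∙-mem : ∀ {x y} → mem x → mem y → mem (x ∙ y)
      ⁻¹-mem : ∀ {x} → mem x → mem (x ⁻¹)
  open Subgroup public

  wholeSubgroup : Subgroup (c ⊔ ℓ)
  wholeSubgroup = record
    { mem = λ _ → ⊤ ; resp = λ _ _ → _ ; ε-mem = _ ; ∙-mem = λ _ _ → _ ; ⁻¹-mem = λ _ → _ }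

  open Mem setoid using (_∈_) public

  FinSubset : Set (c ⊔ ℓ)
  FinSubset = Σ (List Carrier) (Uniq.Unique setoid)

  card : FinSubset → ℕ
  card (xs , _) = length xs

  elems : FinSubset → List Carrier
  elems (xs , _) = xs

  AgreeOn : ∀ {p q} → FinSubset → Subgroup p → Subgroup q → Set (c ⊔ ℓ ⊔ p ⊔ q)
  AgreeOn S H K = ∀ s → s ∈ elems S → (mem H s ⇔ mem K s)

  SameSubgroup : ∀ {p q} → Subgroup p → Subgroup q → Set (c ⊔ p ⊔ q)
  SameSubgroup H K = ∀ x → (mem H x ⇔ mem K x)

  Occam : ∀ {p} → Subgroup p → FinSubset → Set (c ⊔ suc ℓ ⊔ suc c ⊔ p)
  Occam H S = (K : Subgroup (c ⊔ ℓ)) → AgreeOn S H K → SameSubgroup H K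

  -- R_G(H) = n (n finite).  R_G(H) = ∞ iff no n satisfies this.
  RadiusIs : ∀ {p} → Subgroup p → ℕ → Set (suc c ⊔ suc ℓ ⊔ p)
  RadiusIs H n = (Σ FinSubset λ S → card S ≡' n × Occam H S)
               × (∀ S → Occam H S → n ≤ card S)
    where open import Relation.Binary.PropositionalEquality using () renaming (_≡_ to _≡'_)

  data Generated (S : List Carrier) : Carrier → Set (c ⊔ ℓ) where
    gen  : ∀ {x} → x ∈ S → Generated S x
    unit : Generated S ε
    mul  : ∀ {x y} → Generated S x → Generated S y → Generated S (x ∙ y)
    inv  : ∀ {x} → Generated S x → Generated S (x ⁻¹)
    resp≈ : ∀ {x y} → x ≈ y → Generated S x → Generated S y

  Generates : FinSubset → Set (c ⊔ ℓ)
  Generates S = ∀ x → Generated (elems S) x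

  -- rank(G) = n (n finite). rank(G) = ∞ iff no n satisfies this.
  RankIs : ℕ → Set (c ⊔ ℓ)
  RankIs n = (Σ FinSubset λ S → card S ≡' n × Generates S)
           × (∀ S → Generates S → n ≤ card S)
    where open import Relation.Binary.PropositionalEquality using () renaming (_≡_ to _≡'_)

-- A subgroup agrees with χ_G on S exactly when it contains S, and the smallest such
-- subgroup is the one generated by S. So χ_G is Occam on S iff S generates G, and
-- the two minimal cardinalities are minima over the same family of finite sets.
module Submission where

open import Defs hiding (_∈_)
open import Level using (Level; _⊔_)
open import Algebra.Bundles using (Group)
open import Data.List using (List)
open import Data.Nat using (ℕ)
open import Data.Product using (_,_)
open import Function.Bundles using (_⇔_; mk⇔; Equivalence)
import Data.List.Membership.Setoid as Membership

module _ {c ℓ : Level} (G : Group c ℓ) where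
  open Group G
  open Membership setoid using (_∈_)

  generatedSubgroup : List Carrier → Subgroup G (c ⊔ ℓ)
  generatedSubgroup xs = record
    { mem = Generated G xs ; resp = resp≈ ; ε-mem = unit ; ∙-mem = mul ; ⁻¹-mem = inv }

  Generated⇒mem : ∀ {p} {xs : List Carrier} (K : Subgroup G p) →
                  (∀ {x} → x ∈ xs → mem K x) → ∀ {x} → Generated G xs x → mem K x
  Generated⇒mem K xs⊆K (gen x∈xs)  = xs⊆K x∈xs
  Generated⇒mem K xs⊆K unit        = ε-mem K
  Generated⇒mem K xs⊆K (mul gx gy) = ∙-mem K (Generated⇒mem K xs⊆K gx) (Generated⇒mem K xs⊆K gy)
  Generated⇒mem K xs⊆K (inv gx)    = ⁻¹-mem K (Generated⇒mem K xs⊆K gx)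
  Generated⇒mem K xs⊆K (resp≈ x≈y gx) = resp K x≈y (Generated⇒mem K xs⊆K gx)

  occam⇔generates : ∀ S → Occam G (wholeSubgroup G) S ⇔ Generates G S
  occam⇔generates S = mk⇔ occam⇒generates generates⇒occam
    where
    occam⇒generates : Occam G (wholeSubgroup G) S → Generates G S
    occam⇒generates occam x =
      Equivalence.to (occam (generatedSubgroup (elems G S)) agree x) _
      where
      agree : AgreeOn G S (wholeSubgroup G) (generatedSubgroup (elems G S))
      agree s s∈S = mk⇔ (λ _ → gen s∈S) _

    generates⇒occam : Generates G S → Occam G (wholeSubgroup G) S
    generates⇒occam generates K agree x =
      mk⇔ (λ _ → Generated⇒mem K (λ s∈S → Equivalence.to (agree _ s∈S) _) (generates x)) _

theorem2p1 : ∀ {c ℓ : Level} (G : Group c ℓ) (n : ℕ) →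
    RadiusIs G (wholeSubgroup G) n ⇔ RankIs G n
theorem2p1 G n = mk⇔
  (λ { ((S , ∣S∣≡n , occam) , minimal) →
         (S , ∣S∣≡n , to (occam⇔generates G S) occam)
       , (λ T generates → minimal T (from (occam⇔generates G T) generates)) })
  (λ { ((S , ∣S∣≡n , generates) , minimal) →
         (S , ∣S∣≡n , from (occam⇔generates G S) generates)
       , (λ T occam → minimal T (to (occam⇔generates G T) occam)) })
  where open Equivalence
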